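{- In type $(A_{n-1},j)$, let $O\subseteq Q$ be an order ideal and let $x<y$ be boxes of $O$ such that the interval $[x,y]$ (the rectangle of boxes whose rows lie between those of $x$ and $y$ and whose columns lie between those of $x$ and $y$) has at least two rows and at least two columns. Let $S_0:(x,y)\to\{0,+,?\}$ be the filling which is $+$ at the box in the row of $y$ and the column of $x$ and at the box in the row of $x$ and the column of $y$, and $0$ at every other box of $(x,y)$. Then $(x,y,S_0)$ is a $\Gamma$-move.
   Context: $W=S_n$ with simple reflections $s_i=(i,i+1)$, Bruhat order $<$. $Q$ is the set of boxes $(r,c)$, $1\le r\le j$ (rows numbered top to bottom), $1\le c\le n-j$ (columns left to right), with label $s_{(r,c)}=s_{r+c-1}$; the order on $Q$ is the transitive closure of $(r,c)\lessdot(r,c+1)$ and $(r,c)\lessdot(r-1,c)$, so $x$ is the bottom-left and $y$ the top-right corner of $[x,y]$. A subset $C\subseteq Q$ is convex if $x,y\in C$, $x<z<y$ imply $z\in C$. For a convex $C$ and a map $D:C\to\{0,+\}$ (an $\oplus$-diagram of shape $C$), take a linear extension $b_1,\dots,b_m$ of $C$ and let $v(D)\in W$ be the product $t_m t_{m-1}\cdots t_1$ where $t_k=s_{b_k}$ if $D(b_k)=0$ and $t_k=1$ if $D(b_k)=+$ (this is independent of the linear extension). Write $(x,y)=\{z: x<z<y\}$, $[x,y)=\{z:x\le z<y\}$, $(x,y]=\{z:x<z\le y\}$. A diagram $D$ of shape $(x,y)$ is compatible with $S:(x,y)\to\{0,+,?\}$ if $D(z)=S(z)$ whenever $S(z)\ne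 ?$. A $\Gamma$-move is a triple $(x,y,S)$ with $x<y$ distinct boxes and $S:(x,y)\to\{0,+,?\}$ such that $v(D\cup x)=v(D\cup y)$ for every $D$ of shape $(x,y)$ compatible with $S$, where $D\cup x$ (resp. $D\cup y$) is the diagram of shape $[x,y)$ (resp. $(x,y]$) extending $D$ by a $0$ at $x$ (resp. $y$). -}

module Defs where

open import Data.Nat using (ℕ; zero; suc; _+_; _∸_; _≤_; _<_; _≟_)
open import Data.Nat.Properties using (_≤?_)
open import Data.Fin using (Fin; toℕ)
open import Data.Fin.Properties using () renaming (_≟_ to _≟F_)
open import Data.Product using (_×_; _,_; proj₁; proj₂)
open import Data.Product.Properties using (≡-dec)
open import Data.List using (List; []; _∷_; map; concatMap; reverse; allFin; foldl)
open import Relation.Nullary using (¬_; Dec; yes; no; _×-dec_; ¬?)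
open import Relation.Unary using (Pred; Decidable)
open import Relation.Binary.PropositionalEquality using (_≡_; _≢_; _≗_)
open import Level using (0ℓ)

-- A box (r , c) is stored 0-indexed: r : Fin j (row, numbered top to
-- bottom), c : Fin (n ∸ j) (column, numbered left to right).
-- Paper box (r+1, c+1) ↔ our (r , c).

Box : ℕ → ℕ → Set
Box n j = Fin j × Fin (n ∸ j)

module _ {n j : ℕ} where

  row col : Box n j → ℕ
  row b = toℕ (proj₁ b)
  col b = toℕ (proj₂ b)

  -- label s_{(r,c)} = s_{r+c-1} in the paper's 1-indexed coordinates
  -- = s_{row+col+1} in our 0-indexed coordinates.
  label : Box n j → ℕ
  label b = row b + col b + 1

  -- order on Q: transitive closure of (r,c) ⋖ (r,c+1) and (r,c) ⋖ (r-1,c),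
  -- i.e. a ≤ b iff b is weakly above and weakly to the right of a.
  _≤Q_ : Box n j → Box n j → Set
  a ≤Q b = (row b ≤ row a) × (col a ≤ col b)

  _<Q_ : Box n j → Box n j → Set
  a <Q b = (a ≤Q b) × (a ≢ b)

  _≟B_ : (a b : Box n j) → Dec (a ≡ b)
  _≟B_ = ≡-dec _≟F_ _≟F_

  _≤Q?_ : (a b : Box n j) → Dec (a ≤Q b)
  a ≤Q? b = (row b ≤? row a) ×-dec (col a ≤? col b)

  _<Q?_ : (a b : Box n j) → Dec (a <Q b)
  a <Q? b = (a ≤Q? b) ×-dec ¬? (a ≟B b)

  OrderIdeal : Pred (Box n j) 0ℓ → Set
  OrderIdeal O = ∀ a b → a ≤Q b → O b → O a

  Open : Box n j → Box n j → Pred (Box n j) 0ℓ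
  Open x y z = (x <Q z) × (z <Q y)

  ClosedOpen : Box n j → Box n j → Pred (Box n j) 0ℓ
  ClosedOpen x y z = (x ≤Q z) × (z <Q y)

  OpenClosed : Box n j → Box n j → Pred (Box n j) 0ℓ
  OpenClosed x y z = (x <Q z) × (z ≤Q y)

  ClosedOpen? : ∀ x y → Decidable (ClosedOpen x y)
  ClosedOpen? x y z = (x ≤Q? z) ×-dec (z <Q? y)

  OpenClosed? : ∀ x y → Decidable (OpenClosed x y)
  OpenClosed? x y z = (x <Q? z) ×-dec (z ≤Q? y)

data Sign : Set where
  ⊙0 ⊙+ : Sign

data Fill : Set where
  f0 f+ f? : Fill

embed : Sign → Fill
embed ⊙0 = f0
embed ⊙+ = f+

-- Elements of S_n as permutations of ℕ fixing everything outside
-- {1,…,n}; s_i = (i, i+1).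

Perm : Set
Perm = ℕ → ℕ

s : ℕ → Perm
s i k with k ≟ i
... | yes _ = suc i
... | no _ with k ≟ suc i
...   | yes _ = i
...   | no _ = k

idP : Perm
idP k = k

_·_ : Perm → Perm → Perm
(u · w) k = u (w k)

module _ {n j : ℕ} where

  -- A fixed linear extension of the whole poset Q: rows from bottom to
  -- top, and within a row columns from left to right.  Its restriction
  -- to any subset C is a linear extension of C.
  linExt : List (Box n j)
  linExt = concatMap (λ r → map (λ c → (r , c)) (allFin (n ∸ j))) (reverse (allFin j))

  -- v(D) for a diagram D of (decidable) shape C: the product t_m ⋯ t_1
  -- over the linear extension b_1,…,b_m of C, where t_k = s_{b_k} if
  -- D(b_k) = 0 and t_k = 1 if D(b_k) = +.
  v : (C : Pred (Box n j) 0ℓ) → Decidable C → (Box n j → Sign) → Perm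
  v C C? D = foldl step idP linExt
    where
    step : Perm → Box n j → Perm
    step w b with C? b
    ... | no _ = w
    ... | yes _ with D b
    ...   | ⊙0 = s (label b) · w
    ...   | ⊙+ = w

  _∪0_ : (Box n j → Sign) → Box n j → (Box n j → Sign)
  (D ∪0 a) b with b ≟B a
  ... | yes _ = ⊙0
  ... | no _ = D b

  Compatible : Box n j → Box n j → (Box n j → Fill) → (Box n j → Sign) → Set
  Compatible x y S D = ∀ z → Open x y z → S z ≢ f? → embed (D z) ≡ S z

  GammaMove : Box n j → Box n j → (Box n j → Fill) → Set
  GammaMove x y S =
    (x <Q y) ×
    (∀ (D : Box n j → Sign) → Compatible x y S D →
       v (ClosedOpen x y) (ClosedOpen? x y) (D ∪0 x)
         ≗ v (OpenClosed x y) (OpenClosed? x y) (D ∪0 y))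

  S₀ : Box n j → Box n j → Box n j → Fill
  S₀ x y z with row z ≟ row y | col z ≟ col x
  ... | yes _ | yes _ = f+
  ... | _ | _ with row z ≟ row x | col z ≟ col y
  ...   | yes _ | yes _ = f+
  ...   | _ | _ = f0

module Submission where

-- Read along the linear extension (rows bottom to top, each row left to right), every row of
-- [x, y] contributes a cycle cyc a d = s (a + d - 1) ⋯ s a.  The rows strictly between those of
-- y and x contribute the same product M to both sides.  Let p and q be the labels of x and y,
-- A the label of the box right of the top-left corner and K = q - A.  The two sides are
-- cyc A K · M · cyc p (K + 1) = X · s p  and  cyc A (K + 1) · M · cyc (p + 1) K = s q · X
-- with X = cyc A K · M · cyc (p + 1) K.  The middle rows form a staircase carrying p and
-- p + K + 1 to A and A + K + 1, so the bijection X sends p, p + 1 to q, q + 1 and therefore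
-- conjugates s p into s q.

open import Defs
open import Data.Nat using (ℕ; zero; suc; _+_; _∸_; _≤_; _<_; _≟_; s≤s; z<s)
open import Data.Nat.Properties
open import Data.Nat.Tactic.RingSolver using (solve-∀)
open import Data.Fin as Fin using (Fin; toℕ)
open import Data.Fin.Properties using (toℕ-injective; toℕ<n)
open import Data.List using (List; []; _∷_; _++_; map; concatMap; reverse; allFin; foldl; tabulate)
open import Data.List.Properties using (unfold-reverse)
open import Data.Product using (Σ; _×_; _,_; proj₁; proj₂)
open import Data.Product.Properties using (≡-dec; ,-injectiveˡ; ,-injectiveʳ)
open import Data.Sum using (_⊎_; inj₁; inj₂; [_,_])
open import Function using (_∘_)
open import Function.Bundles using (_⇔_; mk⇔; Equivalence)
open import Function.Definitions using (Injective)
open import Relation.Binary.PropositionalEquality using (_≡_; _≢_; refl; sym; trans; cong; cong₂; subst; _≗_; module ≡-Reasoning)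
open import Relation.Nullary using (¬_; Dec; yes; no; _×-dec_; ¬?; contradiction)
open import Relation.Nullary.Decidable using (dec-yes)
open import Relation.Unary using (Pred; Decidable)
open import Level using (0ℓ)

s-fix : ∀ i {k} → k ≢ i → k ≢ suc i → s i k ≡ k
s-fix i {k} k≢i k≢1+i with k ≟ i
... | yes k≡i = contradiction k≡i k≢i
... | no _ with k ≟ suc i
...   | yes k≡1+i = contradiction k≡1+i k≢1+i
...   | no _ = refl

s-left : ∀ i → s i i ≡ suc i
s-left i rewrite ≟-diag (refl {x = i}) = refl

s-right : ∀ i → s i (suc i) ≡ i
s-right i with suc i ≟ i
... | yes 1+i≡i = contradiction 1+i≡i (1+n≢n)
... | no _ rewrite ≟-diag (refl {x = suc i}) = refl

s-involutive : ∀ i k → s i (s i k) ≡ k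
s-involutive i k = by-cases (k ≟ i) (k ≟ suc i)
  where
  by-cases : Dec (k ≡ i) → Dec (k ≡ suc i) → s i (s i k) ≡ k
  by-cases (yes refl) _ = trans (cong (s k) (s-left k)) (s-right k)
  by-cases (no _) (yes refl) = trans (cong (s i) (s-right i)) (s-left i)
  by-cases (no k≢i) (no k≢1+i) = trans (cong (s i) (s-fix i k≢i k≢1+i)) (s-fix i k≢i k≢1+i)

s-injective : ∀ i → Injective _≡_ _≡_ (s i)
s-injective i {k} {l} eq = begin
  k             ≡⟨ s-involutive i k ⟨
  s i (s i k)   ≡⟨ cong (s i) eq ⟩
  s i (s i l)   ≡⟨ s-involutive i l ⟩
  l             ∎
  where open ≡-Reasoning

s-conjugate : ∀ {p q} (X : Perm) → Injective _≡_ _≡_ X → X p ≡ q → X (suc p) ≡ suc q →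
              X · s p ≗ s q · X
s-conjugate {p} {q} X X-inj Xp≡q Xp+1≡q+1 k = by-cases (k ≟ p) (k ≟ suc p)
  where
  by-cases : Dec (k ≡ p) → Dec (k ≡ suc p) → X (s p k) ≡ s q (X k)
  by-cases (yes refl) _ = begin
    X (s k k)        ≡⟨ cong X (s-left k) ⟩
    X (suc k)        ≡⟨ Xp+1≡q+1 ⟩
    suc q            ≡⟨ s-left q ⟨
    s q q            ≡⟨ cong (s q) Xp≡q ⟨
    s q (X k)        ∎
    where open ≡-Reasoning
  by-cases (no _) (yes refl) = begin
    X (s p (suc p))  ≡⟨ cong X (s-right p) ⟩
    X p              ≡⟨ Xp≡q ⟩
    q                ≡⟨ s-right q ⟨
    s q (suc q)      ≡⟨ cong (s q) Xp+1≡q+1 ⟨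
    s q (X (suc p))  ∎
    where open ≡-Reasoning
  by-cases (no k≢p) (no k≢1+p) = begin
    X (s p k)        ≡⟨ cong X (s-fix p k≢p k≢1+p) ⟩
    X k              ≡⟨ s-fix q (λ Xk≡q → k≢p (X-inj (trans Xk≡q (sym Xp≡q))))
                                (λ Xk≡q+1 → k≢1+p (X-inj (trans Xk≡q+1 (sym Xp+1≡q+1)))) ⟨
    s q (X k)        ∎
    where open ≡-Reasoning

-- cyc a n is the cycle a ↦ a + n ↦ a + n - 1 ↦ ⋯ ↦ a + 1 ↦ a.
cyc : ℕ → ℕ → Perm
cyc a zero = idP
cyc a (suc n) = cyc (suc a) n · s a

cyc-fix-below : ∀ a n {k} → k < a → cyc a n k ≡ k
cyc-fix-below a zero k<a = refl
cyc-fix-below a (suc n) {k} k<a =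
  trans (cong (cyc (suc a) n) (s-fix a (<⇒≢ k<a) (<⇒≢ k<1+a))) (cyc-fix-below (suc a) n k<1+a)
  where
  k<1+a : k < suc a
  k<1+a = m<n⇒m<1+n k<a

cyc-fix-above : ∀ a n {k} → a + n < k → cyc a n k ≡ k
cyc-fix-above a zero a+0<k = refl
cyc-fix-above a (suc n) {k} a+1+n<k =
  trans (cong (cyc (suc a) n) (s-fix a (>⇒≢ a<k) (>⇒≢ 1+a<k))) (cyc-fix-above (suc a) n 1+a+n<k)
  where
  1+a+n<k : suc a + n < k
  1+a+n<k = subst (_< k) (+-suc a n) a+1+n<k
  1+a<k : suc a < k
  1+a<k = ≤-<-trans (m≤m+n (suc a) n) 1+a+n<k
  a<k : a < k
  a<k = <-trans (n<1+n a) 1+a<k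

cyc-start : ∀ a n → cyc a n a ≡ a + n
cyc-start a zero = sym (+-identityʳ a)
cyc-start a (suc n) =
  trans (cong (cyc (suc a) n) (s-left a)) (trans (cyc-start (suc a) n) (sym (+-suc a n)))

cyc-shift : ∀ a n {i} → i < n → cyc a n (suc (a + i)) ≡ a + i
cyc-shift a (suc n) {zero} _ rewrite +-identityʳ a =
  trans (cong (cyc (suc a) n) (s-right a)) (cyc-fix-below (suc a) n (n<1+n a))
cyc-shift a (suc n) {suc i} (s≤s i<n) rewrite +-suc a i =
  trans (cong (cyc (suc a) n) (s-fix a (>⇒≢ a<2+a+i) (>⇒≢ (s≤s a<1+a+i)))) (cyc-shift (suc a) n i<n)
  where
  a<1+a+i : a < suc (a + i)
  a<1+a+i = s≤s (m≤m+n a i)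
  a<2+a+i : a < suc (suc (a + i))
  a<2+a+i = m<n⇒m<1+n a<1+a+i

cyc-extend : ∀ a n → cyc a (suc n) ≗ s (a + n) · cyc a n
cyc-extend a zero k rewrite +-identityʳ a = refl
cyc-extend a (suc n) k rewrite +-suc a n = cyc-extend (suc a) n (s a k)

cyc-injective : ∀ a n → Injective _≡_ _≡_ (cyc a n)
cyc-injective a zero eq = eq
cyc-injective a (suc n) eq = s-injective a (cyc-injective (suc a) n eq)

prod : (ℕ → Perm) → ℕ → Perm
prod R zero = idP
prod R (suc n) = prod R n · R n

prodRev : (ℕ → Perm) → ℕ → Perm
prodRev F zero = idP
prodRev F (suc n) = prodRev (F ∘ suc) n · F 0

prod-injective : ∀ R n → (∀ i → Injective _≡_ _≡_ (R i)) → Injective _≡_ _≡_ (prod R n)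
prod-injective R zero R-inj eq = eq
prod-injective R (suc n) R-inj eq = R-inj n (prod-injective R n R-inj eq)

prod-cong : ∀ {R R′} n → (∀ i → i < n → R i ≗ R′ i) → prod R n ≗ prod R′ n
prod-cong zero R≗R′ k = refl
prod-cong {R} {R′} (suc n) R≗R′ k =
  trans (cong (prod R n) (R≗R′ n ≤-refl k)) (prod-cong n (λ i i<n → R≗R′ i (m<n⇒m<1+n i<n)) (R′ n k))

prod-idle : ∀ {R} n → (∀ i → i < n → R i ≗ idP) → prod R n ≗ idP
prod-idle zero R≗id k = refl
prod-idle {R} (suc n) R≗id k =
  trans (cong (prod R n) (R≗id n ≤-refl k)) (prod-idle n (λ i i<n → R≗id i (m<n⇒m<1+n i<n)) k)

prodRev-idle : ∀ {F} n → (∀ i → i < n → F i ≗ idP) → prodRev F n ≗ idP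
prodRev-idle zero F≗id k = refl
prodRev-idle {F} (suc n) F≗id k =
  trans (cong (prodRev (F ∘ suc) n) (F≗id 0 z<s k)) (prodRev-idle n (λ i i<n → F≗id (suc i) (s≤s i<n)) k)

prod-split : ∀ R a b → prod R (a + b) ≗ prod R a · prod (λ i → R (a + i)) b
prod-split R a zero k rewrite +-identityʳ a = refl
prod-split R a (suc b) k rewrite +-suc a b = prod-split R a b (R (a + b) k)

prodRev-split : ∀ F a b → prodRev F (a + b) ≗ prodRev (λ i → F (a + i)) b · prodRev F a
prodRev-split F zero b k = refl
prodRev-split F (suc a) b k = prodRev-split (F ∘ suc) a b (F 0 k)

prod-window : ∀ {R} a d e → (∀ i → i < a → R i ≗ idP) → (∀ i → a + d ≤ i → R i ≗ idP) →
              prod R (a + (d + e)) ≗ prod (λ i → R (a + i)) d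
prod-window {R} a d e idle-below idle-above k = begin
  prod R (a + (d + e)) k                 ≡⟨ prod-split R a (d + e) k ⟩
  prod R a (prod R′ (d + e) k)           ≡⟨ prod-idle a idle-below _ ⟩
  prod R′ (d + e) k                      ≡⟨ prod-split R′ d e k ⟩
  prod R′ d (prod (λ i → R′ (d + i)) e k) ≡⟨ cong (prod R′ d) (prod-idle e idle-tail k) ⟩
  prod R′ d k                            ∎
  where
  open ≡-Reasoning
  R′ : ℕ → Perm
  R′ i = R (a + i)
  idle-tail : ∀ i → i < e → R′ (d + i) ≗ idP
  idle-tail i _ = idle-above _ (+-monoʳ-≤ a (m≤m+n d i))

prodRev-window : ∀ {F} a d e → (∀ i → i < a → F i ≗ idP) → (∀ i → a + d ≤ i → F i ≗ idP) →
                 prodRev F (a + (d + e)) ≗ prodRev (λ i → F (a + i)) d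
prodRev-window {F} a d e idle-below idle-above k = begin
  prodRev F (a + (d + e)) k                     ≡⟨ prodRev-split F a (d + e) k ⟩
  prodRev F′ (d + e) (prodRev F a k)            ≡⟨ cong (prodRev F′ (d + e)) (prodRev-idle a idle-below k) ⟩
  prodRev F′ (d + e) k                          ≡⟨ prodRev-split F′ d e k ⟩
  prodRev (λ i → F′ (d + i)) e (prodRev F′ d k) ≡⟨ prodRev-idle e idle-tail _ ⟩
  prodRev F′ d k                                ∎
  where
  open ≡-Reasoning
  F′ : ℕ → Perm
  F′ i = F (a + i)
  idle-tail : ∀ i → i < e → F′ (d + i) ≗ idP
  idle-tail i _ = idle-above _ (+-monoʳ-≤ a (m≤m+n d i))

prod-peel : ∀ R n → prod R (suc n) ≗ R 0 · prod (R ∘ suc) n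
prod-peel R n = prod-split R 1 n

prod-frame : ∀ {R} a t e → (∀ i → i < a → R i ≗ idP) → (∀ i → a + suc t < i → R i ≗ idP) →
             prod R (a + (suc (suc t) + e)) ≗ R a · (prod (λ i → R (a + suc i)) t · R (a + suc t))
prod-frame {R} a t e idle-below idle-above k = begin
  prod R (a + (suc (suc t) + e)) k  ≡⟨ prod-window a (suc (suc t)) e idle-below idle-beyond k ⟩
  prod R′ (suc (suc t)) k           ≡⟨ prod-peel R′ t (R′ (suc t) k) ⟩
  R (a + 0) inner                   ≡⟨ cong (λ b → R b inner) (+-identityʳ a) ⟩
  R a inner                         ∎
  where
  open ≡-Reasoning
  R′ : ℕ → Perm
  R′ i = R (a + i)
  inner : ℕ
  inner = prod (R′ ∘ suc) t (R′ (suc t) k)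
  idle-beyond : ∀ i → a + suc (suc t) ≤ i → R i ≗ idP
  idle-beyond i a+2+t≤i = idle-above i (subst (_≤ i) (+-suc a (suc t)) a+2+t≤i)

prodRev-cyc : ∀ {F} a n → (∀ i → i < n → F i ≗ s (a + i)) → prodRev F n ≗ cyc a n
prodRev-cyc a zero F≗s k = refl
prodRev-cyc {F} a (suc n) F≗s k =
  trans (cong (prodRev (F ∘ suc) n) (trans (F≗s 0 z<s k) (cong (λ i → s i k) (+-identityʳ a))))
        (prodRev-cyc (suc a) n F∘suc≗s (s a k))
  where
  F∘suc≗s : ∀ i → i < n → F (suc i) ≗ s (suc a + i)
  F∘suc≗s i i<n k = trans (F≗s (suc i) (s≤s i<n) k) (cong (λ i → s i k) (+-suc a i))

-- The factor cyc (A + r) (suc L) moves each of A + r + 1, …, A + r + suc L down by one.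
prod-cyc-descend : ∀ A L t {i} → i < suc L → prod (λ r → cyc (A + r) (suc L)) t (A + t + i) ≡ A + i
prod-cyc-descend A L zero {i} _ = cong (_+ i) (+-identityʳ A)
prod-cyc-descend A L (suc t) {i} i<1+L = begin
  M t (cyc (A + t) (suc L) (A + suc t + i))    ≡⟨ cong (M t ∘ cyc (A + t) (suc L)) (+-suc-left A t i) ⟩
  M t (cyc (A + t) (suc L) (suc (A + t + i)))  ≡⟨ cong (M t) (cyc-shift (A + t) (suc L) i<1+L) ⟩
  M t (A + t + i)                              ≡⟨ prod-cyc-descend A L t i<1+L ⟩
  A + i                                        ∎
  where
  open ≡-Reasoning
  M : ℕ → Perm
  M = prod (λ r → cyc (A + r) (suc L))
  +-suc-left : ∀ A t i → A + suc t + i ≡ suc (A + t + i)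
  +-suc-left = solve-∀

-- The left side is X · s p and the right side is s (A + K) · X for the same X.
corner-exchange : ∀ A K p (M : Perm) → Injective _≡_ _≡_ M → M p ≡ A → M (p + suc K) ≡ A + suc K →
                  cyc A K · (M · cyc p (suc K)) ≗ cyc A (suc K) · (M · cyc (suc p) K)
corner-exchange A K p M M-inj Mp≡A Mp+1+K≡A+1+K k =
  trans (s-conjugate X X-inj Xp≡A+K Xp+1≡A+K+1 k) (sym (cyc-extend A K (M (cyc (suc p) K k))))
  where
  open ≡-Reasoning
  X : Perm
  X = cyc A K · (M · cyc (suc p) K)
  X-inj : Injective _≡_ _≡_ X
  X-inj = cyc-injective (suc p) K ∘ M-inj ∘ cyc-injective A K
  Xp≡A+K : X p ≡ A + K
  Xp≡A+K = begin
    cyc A K (M (cyc (suc p) K p))  ≡⟨ cong (cyc A K ∘ M) (cyc-fix-below (suc p) K (n<1+n p)) ⟩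
    cyc A K (M p)                  ≡⟨ cong (cyc A K) Mp≡A ⟩
    cyc A K A                      ≡⟨ cyc-start A K ⟩
    A + K                          ∎
  Xp+1≡A+K+1 : X (suc p) ≡ suc (A + K)
  Xp+1≡A+K+1 = begin
    cyc A K (M (cyc (suc p) K (suc p)))  ≡⟨ cong (cyc A K ∘ M) (trans (cyc-start (suc p) K) (sym (+-suc p K))) ⟩
    cyc A K (M (p + suc K))              ≡⟨ cong (cyc A K) Mp+1+K≡A+1+K ⟩
    cyc A K (A + suc K)                  ≡⟨ cyc-fix-above A K (+-monoʳ-< A (n<1+n K)) ⟩
    A + suc K                            ≡⟨ +-suc A K ⟩
    suc (A + K)                          ∎

listProduct : {A : Set} → (A → Perm) → List A → Perm
listProduct g [] = idP
listProduct g (a ∷ as) = listProduct g as · g a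

listProductʳ : {A : Set} → (A → Perm) → List A → Perm
listProductʳ g [] = idP
listProductʳ g (a ∷ as) = g a · listProductʳ g as

module _ {A : Set} (g : A → Perm) where

  listProduct-++ : ∀ as bs → listProduct g (as ++ bs) ≡ listProduct g bs · listProduct g as
  listProduct-++ [] bs = refl
  listProduct-++ (a ∷ as) bs = cong (_· g a) (listProduct-++ as bs)

  listProduct-reverse : ∀ as → listProduct g (reverse as) ≡ listProductʳ g as
  listProduct-reverse [] = refl
  listProduct-reverse (a ∷ as) = begin
    listProduct g (reverse (a ∷ as))          ≡⟨ cong (listProduct g) (unfold-reverse a as) ⟩
    listProduct g (reverse as ++ a ∷ [])       ≡⟨ listProduct-++ (reverse as) (a ∷ []) ⟩
    g a · listProduct g (reverse as)           ≡⟨ cong (g a ·_) (listProduct-reverse as) ⟩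
    g a · listProductʳ g as                    ∎
    where open ≡-Reasoning

  listProduct-concatMap : {B : Set} (f : B → List A) (bs : List B) →
                          listProduct g (concatMap f bs) ≡ listProduct (listProduct g ∘ f) bs
  listProduct-concatMap f [] = refl
  listProduct-concatMap f (b ∷ bs) =
    trans (listProduct-++ (f b) (concatMap f bs)) (cong (_· listProduct g (f b)) (listProduct-concatMap f bs))

  listProduct-map : {B : Set} (f : B → A) (bs : List B) → listProduct g (map f bs) ≡ listProduct (g ∘ f) bs
  listProduct-map f [] = refl
  listProduct-map f (b ∷ bs) = cong (_· g (f b)) (listProduct-map f bs)

  listProduct-tabulate : ∀ {m} (h : Fin m → A) (F : ℕ → Perm) → (∀ i → g (h i) ≗ F (toℕ i)) →
                         listProduct g (tabulate h) ≗ prodRev F m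
  listProduct-tabulate {zero} h F g∘h≗F k = refl
  listProduct-tabulate {suc m} h F g∘h≗F k =
    trans (cong (listProduct g (tabulate (h ∘ Fin.suc))) (g∘h≗F Fin.zero k))
          (listProduct-tabulate (h ∘ Fin.suc) (F ∘ suc) (g∘h≗F ∘ Fin.suc) (F 0 k))

  listProductʳ-tabulate : ∀ {m} (h : Fin m → A) (R : ℕ → Perm) → (∀ i → g (h i) ≗ R (toℕ i)) →
                          listProductʳ g (tabulate h) ≗ prod R m
  listProductʳ-tabulate {zero} h R g∘h≗R k = refl
  listProductʳ-tabulate {suc m} h R g∘h≗R k =
    trans (g∘h≗R Fin.zero _)
          (trans (cong (R 0) (listProductʳ-tabulate (h ∘ Fin.suc) (R ∘ suc) (g∘h≗R ∘ Fin.suc) k))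
                 (sym (prod-peel R m k)))

gridProduct : (ℕ → ℕ → Perm) → ℕ → ℕ → Perm
gridProduct G rows cols = prod (λ r → prodRev (G r) cols) rows

onlyIf : {P : Set} → Dec P → Perm → Perm
onlyIf (yes _) f = f
onlyIf (no _) _ = idP

signed : Sign → ℕ → Perm
signed ⊙0 i = s i
signed ⊙+ _ = idP

onlyIf-signed : ∀ {P Q : Set} (p : Dec P) (q : Dec Q) σ i → (Q → P × σ ≡ ⊙0) → (P → ¬ Q → σ ≡ ⊙+) →
                onlyIf p (signed σ i) ≗ onlyIf q (s i)
onlyIf-signed (yes _) (yes q) σ i q⇒zero _ k rewrite proj₂ (q⇒zero q) = refl
onlyIf-signed (yes p) (no ¬q) σ i _ ¬q⇒plus k rewrite ¬q⇒plus p ¬q = refl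
onlyIf-signed (no ¬p) (yes q) σ i q⇒zero _ k = contradiction (proj₁ (q⇒zero q)) ¬p
onlyIf-signed (no _) (no _) σ i _ _ k = refl

module _ {n j : ℕ} {C : Pred (Box n j) 0ℓ} (C? : Decidable C) (D : Box n j → Sign) where

  contribution : Box n j → Perm
  contribution b = onlyIf (C? b) (signed (D b) (label b))

  private
    -- The step function of v is local to its definition; unification recovers it.
    v-as-foldl : Σ (Perm → Box n j → Perm) λ step → v C C? D ≡ foldl step idP linExt
    v-as-foldl = _ , refl

    step-contribution : ∀ w b → proj₁ v-as-foldl w b ≗ contribution b · w
    step-contribution w b k with C? b
    ... | no _ = refl
    ... | yes _ with D b
    ...   | ⊙0 = refl
    ...   | ⊙+ = refl

    foldl-step : ∀ bs w → foldl (proj₁ v-as-foldl) w bs ≗ listProduct contribution bs · w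
    foldl-step [] w k = refl
    foldl-step (b ∷ bs) w k =
      trans (foldl-step bs _ k) (cong (listProduct contribution bs) (step-contribution w b k))

  v-gridProduct : (G : ℕ → ℕ → Perm) → (∀ b → contribution b ≗ G (row b) (col b)) →
                  v C C? D ≗ gridProduct G j (n ∸ j)
  v-gridProduct G contribution≗G k = begin
    v C C? D k
      ≡⟨ cong (λ u → u k) (proj₂ v-as-foldl) ⟩
    foldl (proj₁ v-as-foldl) idP (linExt {n} {j}) k
      ≡⟨ foldl-step linExt idP k ⟩
    listProduct contribution (linExt {n} {j}) k
      ≡⟨ cong (λ u → u k) (listProduct-concatMap contribution rowBoxes (reverse (allFin j))) ⟩
    listProduct (listProduct contribution ∘ rowBoxes) (reverse (allFin j)) k
      ≡⟨ cong (λ u → u k) (listProduct-reverse _ (allFin j)) ⟩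
    listProductʳ (listProduct contribution ∘ rowBoxes) (allFin j) k
      ≡⟨ listProductʳ-tabulate _ (λ r → r) (λ r → prodRev (G r) (n ∸ j)) row≗ k ⟩
    gridProduct G j (n ∸ j) k
      ∎
    where
    open ≡-Reasoning
    rowBoxes : Fin j → List (Box n j)
    rowBoxes r = map (r ,_) (allFin (n ∸ j))
    row≗ : ∀ r → listProduct contribution (rowBoxes r) ≗ prodRev (G (toℕ r)) (n ∸ j)
    row≗ r k = trans (cong (λ u → u k) (listProduct-map contribution (r ,_) (allFin (n ∸ j))))
                     (listProduct-tabulate _ (λ c → c) (G (toℕ r)) (λ c → contribution≗G (r , c)) k)

module Rectangle (ry rx cx cy : ℕ) where

  InRect : ℕ → ℕ → Set
  InRect r c = (r ≤ rx × cx ≤ c) × (ry ≤ r × c ≤ cy)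

  -- The boxes contributing s (r + c + 1) on the side that omits the end o of [x, y];
  -- (ry , cx) and (rx , cy) are the corners where S₀ is +.
  Active : ℕ × ℕ → ℕ → ℕ → Set
  Active o r c = InRect r c × (r , c) ≢ o × (r , c) ≢ (ry , cx) × (r , c) ≢ (rx , cy)

  Active? : ∀ o r c → Dec (Active o r c)
  Active? o r c = (((r ≤? rx) ×-dec (cx ≤? c)) ×-dec ((ry ≤? r) ×-dec (c ≤? cy)))
    ×-dec ¬? ((r , c) ≟² o) ×-dec ¬? ((r , c) ≟² (ry , cx)) ×-dec ¬? ((r , c) ≟² (rx , cy))
    where _≟²_ = ≡-dec _≟_ _≟_

  shapeFactor : ℕ × ℕ → ℕ → ℕ → Perm
  shapeFactor o r c = onlyIf (Active? o r c) (s (r + c + 1))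

  shapeFactor-inactive : ∀ {o r c} → ¬ Active o r c → shapeFactor o r c ≗ idP
  shapeFactor-inactive {o} {r} {c} inactive k with Active? o r c
  ... | yes active = contradiction active inactive
  ... | no _ = refl

  shapeFactor-active : ∀ {o r c} → Active o r c → shapeFactor o r c ≗ s (r + c + 1)
  shapeFactor-active {o} {r} {c} active k with Active? o r c
  ... | yes _ = refl
  ... | no inactive = contradiction active inactive

  inactive-corner : ∀ {o r c} → InRect r c → (r , c) ≢ o → ¬ Active o r c →
                    (r , c) ≡ (ry , cx) ⊎ (r , c) ≡ (rx , cy)
  inactive-corner {o} {r} {c} inRect ≢o inactive
    with ≡-dec _≟_ _≟_ (r , c) (ry , cx) | ≡-dec _≟_ _≟_ (r , c) (rx , cy)
  ... | yes tl | _ = inj₁ tl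
  ... | no _ | yes br = inj₂ br
  ... | no ≢tl | no ≢br = contradiction (inRect , ≢o , ≢tl , ≢br) inactive

  row-cycle : ∀ {o r lo hi} d m → (∀ c → Active o r c ⇔ (lo ≤ c × c < hi)) → lo + d ≡ hi → hi ≤ m →
              prodRev (shapeFactor o r) m ≗ cyc (r + lo + 1) d
  row-cycle {o} {r} {lo} {hi} d m active⇔ lo+d≡hi hi≤m k with m≤n⇒∃[o]m+o≡n hi≤m
  ... | e , hi+e≡m = begin
    prodRev (shapeFactor o r) m k                      ≡⟨ cong (λ m → prodRev (shapeFactor o r) m k) m≡lo+[d+e] ⟩
    prodRev (shapeFactor o r) (lo + (d + e)) k         ≡⟨ prodRev-window lo d e before after k ⟩
    prodRev (λ i → shapeFactor o r (lo + i)) d k       ≡⟨ prodRev-cyc (r + lo + 1) d within k ⟩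
    cyc (r + lo + 1) d k                               ∎
    where
    open ≡-Reasoning
    open Equivalence
    m≡lo+[d+e] : m ≡ lo + (d + e)
    m≡lo+[d+e] = trans (sym hi+e≡m) (trans (cong (_+ e) (sym lo+d≡hi)) (+-assoc lo d e))
    before : ∀ c → c < lo → shapeFactor o r c ≗ idP
    before c c<lo = shapeFactor-inactive (λ active → <⇒≱ c<lo (proj₁ (to (active⇔ c) active)))
    after : ∀ c → lo + d ≤ c → shapeFactor o r c ≗ idP
    after c lo+d≤c = shapeFactor-inactive
      (λ active → <⇒≱ (proj₂ (to (active⇔ c) active)) (subst (_≤ c) lo+d≡hi lo+d≤c))
    within : ∀ i → i < d → shapeFactor o r (lo + i) ≗ s (r + lo + 1 + i)
    within i i<d k = trans
      (shapeFactor-active (from (active⇔ (lo + i)) (m≤m+n lo i , subst (lo + i <_) lo+d≡hi (+-monoʳ-< lo i<d))) k)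
      (cong (λ l → s l k) (reassoc r lo i))
      where
      reassoc : ∀ r lo i → r + (lo + i) + 1 ≡ r + lo + 1 + i
      reassoc = solve-∀

  module _ (ry<rx : ry < rx) (cx<cy : cx < cy) where

    top-row-left : ∀ c → Active (ry , cy) ry c ⇔ (suc cx ≤ c × c < cy)
    top-row-left c = mk⇔
      (λ { (((_ , cx≤c) , (_ , c≤cy)) , ≢y , ≢tl , _) →
           ≤∧≢⇒< cx≤c (≢tl ∘ cong (ry ,_) ∘ sym) , ≤∧≢⇒< c≤cy (≢y ∘ cong (ry ,_)) })
      (λ { (cx<c , c<cy) → ((<⇒≤ ry<rx , <⇒≤ cx<c) , (≤-refl , <⇒≤ c<cy)) ,
           <⇒≢ c<cy ∘ ,-injectiveʳ , >⇒≢ cx<c ∘ ,-injectiveʳ , <⇒≢ ry<rx ∘ ,-injectiveˡ })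

    top-row-right : ∀ c → Active (rx , cx) ry c ⇔ (suc cx ≤ c × c < suc cy)
    top-row-right c = mk⇔
      (λ { (((_ , cx≤c) , (_ , c≤cy)) , _ , ≢tl , _) →
           ≤∧≢⇒< cx≤c (≢tl ∘ cong (ry ,_) ∘ sym) , s≤s c≤cy })
      (λ { (cx<c , c<1+cy) → ((<⇒≤ ry<rx , <⇒≤ cx<c) , (≤-refl , ≤-pred c<1+cy)) ,
           <⇒≢ ry<rx ∘ ,-injectiveˡ , >⇒≢ cx<c ∘ ,-injectiveʳ , <⇒≢ ry<rx ∘ ,-injectiveˡ })

    bottom-row-left : ∀ c → Active (ry , cy) rx c ⇔ (cx ≤ c × c < cy)
    bottom-row-left c = mk⇔
      (λ { (((_ , cx≤c) , (_ , c≤cy)) , _ , _ , ≢br) → cx≤c , ≤∧≢⇒< c≤cy (≢br ∘ cong (rx ,_)) })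
      (λ { (cx≤c , c<cy) → ((≤-refl , cx≤c) , (<⇒≤ ry<rx , <⇒≤ c<cy)) ,
           >⇒≢ ry<rx ∘ ,-injectiveˡ , >⇒≢ ry<rx ∘ ,-injectiveˡ , <⇒≢ c<cy ∘ ,-injectiveʳ })

    bottom-row-right : ∀ c → Active (rx , cx) rx c ⇔ (suc cx ≤ c × c < cy)
    bottom-row-right c = mk⇔
      (λ { (((_ , cx≤c) , (_ , c≤cy)) , ≢x , _ , ≢br) →
           ≤∧≢⇒< cx≤c (≢x ∘ cong (rx ,_) ∘ sym) , ≤∧≢⇒< c≤cy (≢br ∘ cong (rx ,_)) })
      (λ { (cx<c , c<cy) → ((≤-refl , <⇒≤ cx<c) , (<⇒≤ ry<rx , <⇒≤ c<cy)) ,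
           >⇒≢ cx<c ∘ ,-injectiveʳ , >⇒≢ ry<rx ∘ ,-injectiveˡ , <⇒≢ c<cy ∘ ,-injectiveʳ })

    middle-row : ∀ {o r} → ry < r → r < rx → proj₁ o ≢ r → ∀ c → Active o r c ⇔ (cx ≤ c × c < suc cy)
    middle-row {o} ry<r r<rx o≢r c = mk⇔
      (λ { (((_ , cx≤c) , (_ , c≤cy)) , _) → cx≤c , s≤s c≤cy })
      (λ { (cx≤c , c<1+cy) → ((<⇒≤ r<rx , cx≤c) , (<⇒≤ ry<r , ≤-pred c<1+cy)) ,
           o≢r ∘ sym ∘ ,-injectiveˡ , >⇒≢ ry<r ∘ ,-injectiveˡ , <⇒≢ r<rx ∘ ,-injectiveˡ })

<⇒+suc : ∀ {a b} → a < b → Σ ℕ λ t → a + suc t ≡ b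
<⇒+suc {a} a<b with m≤n⇒∃[o]m+o≡n a<b
... | t , 1+a+t≡b = t , trans (+-suc a t) 1+a+t≡b

module NormalisedRectangle (ry t cx K e m : ℕ) (cy<m : cx + suc K < m) where

  rx cy j : ℕ
  rx = ry + suc t
  cy = cx + suc K
  j = rx + suc e

  open Rectangle ry rx cx cy

  ry<rx : ry < rx
  ry<rx = m<m+n ry z<s

  cx<cy : cx < cy
  cx<cy = m<m+n cx z<s

  A p : ℕ
  A = ry + suc cx + 1
  p = rx + cx + 1

  middle : Perm
  middle = prod (λ i → cyc (A + i) (suc (suc K))) t

  rowProduct : ℕ × ℕ → ℕ → Perm
  rowProduct o r = prodRev (shapeFactor o r) m

  row-outside : ∀ {o r} → r < ry ⊎ rx < r → rowProduct o r ≗ idP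
  row-outside (inj₁ r<ry) =
    prodRev-idle m (λ c _ → shapeFactor-inactive λ { ((_ , (ry≤r , _)) , _) → <⇒≱ r<ry ry≤r })
  row-outside (inj₂ rx<r) =
    prodRev-idle m (λ c _ → shapeFactor-inactive λ { (((r≤rx , _) , _) , _) → <⇒≱ rx<r r≤rx })

  row-middle : ∀ {o} → (proj₁ o ≡ ry ⊎ proj₁ o ≡ rx) → ∀ i → i < t →
               rowProduct o (ry + suc i) ≗ cyc (A + i) (suc (suc K))
  row-middle {o} o-row i i<t k = trans
    (row-cycle (suc (suc K)) m (middle-row ry<rx cx<cy ry<r r<rx o≢r) (+-suc cx (suc K)) cy<m k)
    (cong (λ a → cyc a (suc (suc K)) k) (reassoc ry i cx))
    where
    ry<r : ry < ry + suc i
    ry<r = m<m+n ry z<s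
    r<rx : ry + suc i < rx
    r<rx = +-monoʳ-< ry (s≤s i<t)
    o≢r : proj₁ o ≢ ry + suc i
    o≢r = [ (λ { refl → <⇒≢ ry<r }) , (λ { refl → >⇒≢ r<rx }) ] o-row
    reassoc : ∀ ry i cx → ry + suc i + cx + 1 ≡ ry + suc cx + 1 + i
    reassoc = solve-∀

  grid-rows : ∀ o → (proj₁ o ≡ ry ⊎ proj₁ o ≡ rx) →
              gridProduct (shapeFactor o) j m ≗ rowProduct o ry · (middle · rowProduct o rx)
  grid-rows o o-row k = begin
    gridProduct (shapeFactor o) j m k
      ≡⟨ cong (λ j → gridProduct (shapeFactor o) j m k) (reassoc ry t e) ⟩
    gridProduct (shapeFactor o) (ry + (suc (suc t) + e)) m k
      ≡⟨ prod-frame ry t e (λ r r<ry → row-outside (inj₁ r<ry)) (λ r rx<r → row-outside (inj₂ rx<r)) k ⟩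
    rowProduct o ry (prod (λ i → rowProduct o (ry + suc i)) t (rowProduct o rx k))
      ≡⟨ cong (rowProduct o ry) (prod-cong t (row-middle o-row) (rowProduct o rx k)) ⟩
    rowProduct o ry (middle (rowProduct o rx k))
      ∎
    where
    open ≡-Reasoning
    reassoc : ∀ ry t e → ry + suc t + suc e ≡ ry + (suc (suc t) + e)
    reassoc = solve-∀

  grid-left : gridProduct (shapeFactor (ry , cy)) j m ≗ cyc A K · (middle · cyc p (suc K))
  grid-left k = trans (grid-rows (ry , cy) (inj₁ refl) k) (trans
    (row-cycle K m (top-row-left ry<rx cx<cy) (sym (+-suc cx K)) (<⇒≤ cy<m) _)
    (cong (cyc A K ∘ middle) (row-cycle (suc K) m (bottom-row-left ry<rx cx<cy) refl (<⇒≤ cy<m) k)))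

  grid-right : gridProduct (shapeFactor (rx , cx)) j m ≗ cyc A (suc K) · (middle · cyc (suc p) K)
  grid-right k = trans (grid-rows (rx , cx) (inj₂ refl) k) (trans
    (row-cycle (suc K) m (top-row-right ry<rx cx<cy) refl cy<m _)
    (cong (cyc A (suc K) ∘ middle) (trans
      (row-cycle K m (bottom-row-right ry<rx cx<cy) (sym (+-suc cx K)) (<⇒≤ cy<m) k)
      (cong (λ a → cyc a K k) (cong (_+ 1) (+-suc rx cx))))))

  middle-injective : Injective _≡_ _≡_ middle
  middle-injective = prod-injective _ t (λ i → cyc-injective (A + i) (suc (suc K)))

  p≡A+t : p ≡ A + t
  p≡A+t = reassoc ry t cx
    where
    reassoc : ∀ ry t cx → ry + suc t + cx + 1 ≡ ry + suc cx + 1 + t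
    reassoc = solve-∀

  middle-p : middle p ≡ A
  middle-p = begin
    middle p            ≡⟨ cong middle (trans p≡A+t (sym (+-identityʳ (A + t)))) ⟩
    middle (A + t + 0)  ≡⟨ prod-cyc-descend A (suc K) t z<s ⟩
    A + 0               ≡⟨ +-identityʳ A ⟩
    A                   ∎
    where open ≡-Reasoning

  middle-p+1+K : middle (p + suc K) ≡ A + suc K
  middle-p+1+K = trans (cong (λ p → middle (p + suc K)) p≡A+t) (prod-cyc-descend A (suc K) t (n<1+n (suc K)))

rectangle-exchange : ∀ {ry rx cx cy m j} → ry < rx → cx < cy → cy < m → rx < j →
  let open Rectangle ry rx cx cy in
  gridProduct (shapeFactor (ry , cy)) j m ≗ gridProduct (shapeFactor (rx , cx)) j m
rectangle-exchange {ry} {cx = cx} {m = m} ry<rx cx<cy cy<m rx<j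
  with <⇒+suc ry<rx | <⇒+suc cx<cy | <⇒+suc rx<j
... | t , refl | K , refl | e , refl = λ k →
  trans (grid-left k) (trans (corner-exchange A K p middle middle-injective middle-p middle-p+1+K k) (sym (grid-right k)))
  where open NormalisedRectangle ry t cx K e m cy<m

module _ {n j : ℕ} where

  pos : Box n j → ℕ × ℕ
  pos b = row b , col b

  pos-injective : Injective _≡_ _≡_ pos
  pos-injective {_ , _} {_ , _} eq = cong₂ _,_ (toℕ-injective (,-injectiveˡ eq)) (toℕ-injective (,-injectiveʳ eq))

  ∪0-here : ∀ (D : Box n j → Sign) a → (D ∪0 a) a ≡ ⊙0
  ∪0-here D a with a ≟B a
  ... | yes _ = refl
  ... | no a≢a = contradiction refl a≢a

  ∪0-there : ∀ (D : Box n j → Sign) {a b} → b ≢ a → (D ∪0 a) b ≡ D b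
  ∪0-there D {a} {b} b≢a with b ≟B a
  ... | yes b≡a = contradiction b≡a b≢a
  ... | no _ = refl

embed-injective : Injective _≡_ _≡_ embed
embed-injective {⊙0} {⊙0} _ = refl
embed-injective {⊙+} {⊙+} _ = refl

embed≢f? : ∀ σ → embed σ ≢ f?
embed≢f? ⊙0 ()
embed≢f? ⊙+ ()

module _ {n j : ℕ} (x y : Box n j) where

  S₀-corner : ∀ z → pos z ≡ (row y , col x) ⊎ pos z ≡ (row x , col y) → S₀ x y z ≡ f+
  S₀-corner z (inj₁ tl)
    rewrite proj₂ (dec-yes (row z ≟ row y) (,-injectiveˡ tl)) | proj₂ (dec-yes (col z ≟ col x) (,-injectiveʳ tl)) = refl
  S₀-corner z (inj₂ br) with row z ≟ row y | col z ≟ col x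
  ... | yes _ | yes _ = refl
  ... | yes _ | no _
    rewrite proj₂ (dec-yes (row z ≟ row x) (,-injectiveˡ br)) | proj₂ (dec-yes (col z ≟ col y) (,-injectiveʳ br)) = refl
  ... | no _ | _
    rewrite proj₂ (dec-yes (row z ≟ row x) (,-injectiveˡ br)) | proj₂ (dec-yes (col z ≟ col y) (,-injectiveʳ br)) = refl

  S₀-interior : ∀ z → pos z ≢ (row y , col x) → pos z ≢ (row x , col y) → S₀ x y z ≡ f0
  S₀-interior z ≢tl ≢br with row z ≟ row y | col z ≟ col x
  ... | yes r≡ | yes c≡ = contradiction (cong₂ _,_ r≡ c≡) ≢tl
  ... | yes _ | no _ with row z ≟ row x | col z ≟ col y
  ...   | yes r≡ | yes c≡ = contradiction (cong₂ _,_ r≡ c≡) ≢br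
  ...   | yes _ | no _ = refl
  ...   | no _ | _ = refl
  S₀-interior z ≢tl ≢br | no _ | _ with row z ≟ row x | col z ≟ col y
  ...   | yes r≡ | yes c≡ = contradiction (cong₂ _,_ r≡ c≡) ≢br
  ...   | yes _ | no _ = refl
  ...   | no _ | _ = refl

module _ {n j : ℕ} {x y : Box n j} (ry<rx : row y < row x) (cx<cy : col x < col y)
         {D : Box n j → Sign} (compatible : Compatible x y (S₀ x y) D) where

  open Rectangle (row y) (row x) (col x) (col y)

  compatible-value : ∀ {z σ} → Open x y z → S₀ x y z ≡ embed σ → D z ≡ σ
  compatible-value {z} {σ} z∈ S₀z≡σ =
    embed-injective (trans (compatible z z∈ (λ S₀z≡? → embed≢f? σ (trans (sym S₀z≡σ) S₀z≡?))) S₀z≡σ)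

  -- One argument covers both sides: [x, y) with a 0 added at e = x, and (x, y] with a 0 added at e = y.
  side-contribution : ∀ {C} (C? : Decidable C) (e o : Box n j) →
    (∀ b → C b ⇔ (InRect (row b) (col b) × b ≢ o)) → (∀ b → C b → b ≢ e → Open x y b) →
    Active (pos o) (row e) (col e) →
    ∀ b → contribution C? (D ∪0 e) b ≗ shapeFactor (pos o) (row b) (col b)
  side-contribution {C} C? e o C⇔ C⇒Open e-active b =
    onlyIf-signed (C? b) (Active? (pos o) (row b) (col b)) ((D ∪0 e) b) (label b) active⇒zero inactive⇒plus
    where
    open Equivalence
    active⇒zero : Active (pos o) (row b) (col b) → C b × (D ∪0 e) b ≡ ⊙0
    active⇒zero (inRect , ≢o , ≢tl , ≢br) = Cb , value (b ≟B e)
      where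
      Cb : C b
      Cb = from (C⇔ b) (inRect , ≢o ∘ cong pos)
      value : Dec (b ≡ e) → (D ∪0 e) b ≡ ⊙0
      value (yes refl) = ∪0-here D b
      value (no b≢e) = trans (∪0-there D b≢e) (compatible-value (C⇒Open b Cb b≢e) (S₀-interior x y b ≢tl ≢br))
    inactive⇒plus : C b → ¬ Active (pos o) (row b) (col b) → (D ∪0 e) b ≡ ⊙+
    inactive⇒plus Cb inactive = trans (∪0-there D b≢e)
      (compatible-value (C⇒Open b Cb b≢e) (S₀-corner x y b (inactive-corner inRect (≢o ∘ pos-injective) inactive)))
      where
      b≢e : b ≢ e
      b≢e refl = inactive e-active
      inRect : InRect (row b) (col b)
      inRect = proj₁ (to (C⇔ b) Cb)
      ≢o : b ≢ o
      ≢o = proj₂ (to (C⇔ b) Cb)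

  left-contribution : ∀ b → contribution (ClosedOpen? x y) (D ∪0 x) b ≗ shapeFactor (pos y) (row b) (col b)
  left-contribution = side-contribution (ClosedOpen? x y) x y
    (λ b → mk⇔ (λ { (x≤b , b≤y , b≢y) → (x≤b , b≤y) , b≢y })
               (λ { ((x≤b , b≤y) , b≢y) → x≤b , b≤y , b≢y }))
    (λ { b (x≤b , b<y) b≢x → (x≤b , b≢x ∘ sym) , b<y })
    (((≤-refl , ≤-refl) , (<⇒≤ ry<rx , <⇒≤ cx<cy)) ,
     >⇒≢ ry<rx ∘ ,-injectiveˡ , >⇒≢ ry<rx ∘ ,-injectiveˡ , <⇒≢ cx<cy ∘ ,-injectiveʳ)

  right-contribution : ∀ b → contribution (OpenClosed? x y) (D ∪0 y) b ≗ shapeFactor (pos x) (row b) (col b)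
  right-contribution = side-contribution (OpenClosed? x y) y x
    (λ b → mk⇔ (λ { ((x≤b , x≢b) , b≤y) → (x≤b , b≤y) , x≢b ∘ sym })
               (λ { ((x≤b , b≤y) , b≢x) → (x≤b , b≢x ∘ sym) , b≤y }))
    (λ { b (x<b , b≤y) b≢y → x<b , b≤y , b≢y })
    (((<⇒≤ ry<rx , <⇒≤ cx<cy) , (≤-refl , ≤-refl)) ,
     <⇒≢ ry<rx ∘ ,-injectiveˡ , >⇒≢ cx<cy ∘ ,-injectiveʳ , <⇒≢ ry<rx ∘ ,-injectiveˡ)

mainTheorem2 : (n j : ℕ) → 1 ≤ j → j < n →
    (O : Pred (Box n j) 0ℓ) → OrderIdeal O →
    (x y : Box n j) → O x → O y → x <Q y →
    row y < row x → col x < col y →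
    GammaMove x y (S₀ x y)
mainTheorem2 n j _ _ _ _ x y _ _ x<y ry<rx cx<cy = x<y , λ D compatible k → begin
  v (ClosedOpen x y) (ClosedOpen? x y) (D ∪0 x) k
    ≡⟨ v-gridProduct (ClosedOpen? x y) (D ∪0 x) _ (left-contribution ry<rx cx<cy compatible) k ⟩
  gridProduct (shapeFactor (pos y)) j (n ∸ j) k
    ≡⟨ rectangle-exchange ry<rx cx<cy (toℕ<n (proj₂ y)) (toℕ<n (proj₁ x)) k ⟩
  gridProduct (shapeFactor (pos x)) j (n ∸ j) k
    ≡⟨ v-gridProduct (OpenClosed? x y) (D ∪0 y) _ (right-contribution ry<rx cx<cy compatible) k ⟨
  v (OpenClosed x y) (OpenClosed? x y) (D ∪0 y) k
    ∎
  where
  open ≡-Reasoning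
  open Rectangle (row y) (row x) (col x) (col y)
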